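{- Let $G$ be a finite simple connected graph, $G_1,G_2$ disjoint copies of $G$, and $f:V(G_1)\to V(G_2)$ a function. Then $\gamma(G)=\gamma(C(G,f))$ if and only if there are sets $D_1\subseteq V(G_1)$ and $D_2\subseteq V(G_2)$ such that: (1) $D_1$ dominates $V(G_1)\setminus f^{ -1}(D_2)$ (in $G_1$); (2) $D_2$ dominates $V(G_2)\setminus f(D_1)$ (in $G_2$); (3) $D_2\cup f(D_1)$ is a minimum dominating set of $G_2$; (4) $|D_1|=|f(D_1)|$; (5) $D_2\cap f(D_1)=\emptyset$; and (6) $D_1\cap f^{ -1}(D_2)=\emptyset$.
   Context: For disjoint copies $G_1,G_2$ of a graph $G$ and a function $f:V(G_1)\to V(G_2)$, the functigraph $C(G,f)$ has vertex set $V(G_1)\cup V(G_2)$ and edge set $E(G_1)\cup E(G_2)\cup\{uv : u\in V(G_1), v\in V(G_2), v=f(u)\}$. $\gamma(H)$ denotes the domination number of $H$. A set $D$ dominates a set $S$ if every vertex of $S\setminus D$ has a neighbor in $D$. For $S\subseteq V(G_2)$, $f^{ -1}(S)=\{v\in V(G_1): f(v)\in S\}$. -}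

module Defs where

open import Data.Nat using (ℕ; _+_; _≤_)
open import Data.Fin using (Fin; splitAt)
open import Data.Fin.Properties using (any?; _≟_)
open import Data.Fin.Subset using (Subset; _∈_; _∉_; ⊤; ∣_∣)
open import Data.Fin.Subset.Properties using (_∈?_)
open import Data.Vec using (tabulate; lookup)
open import Data.Sum using (_⊎_; inj₁; inj₂)
open import Data.Product using (Σ; ∃; _×_; _,_)
open import Data.Empty using (⊥)
open import Relation.Nullary using (¬_; does)
open import Relation.Nullary.Decidable using (_×-dec_)
open import Relation.Binary.PropositionalEquality using (_≡_)

record Graph (n : ℕ) : Set₁ where
  field
    Adj   : Fin n → Fin n → Set
    sym   : ∀ {u v} → Adj u v → Adj v u
    irrfl : ∀ {u} → ¬ Adj u u
open Graph public

data Walk {n : ℕ} (G : Graph n) : Fin n → Fin n → Set where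
  stay : ∀ {u} → Walk G u u
  step : ∀ {u v w} → Adj G u v → Walk G v w → Walk G u w

Connected : ∀ {n} → Graph n → Set
Connected {n} G = ∀ (u v : Fin n) → Walk G u v

-- Functigraph C(G,f): vertices Fin (n + n); first block = G₁, second = G₂.
FAdj : ∀ {n} → Graph n → (Fin n → Fin n) → Fin n ⊎ Fin n → Fin n ⊎ Fin n → Set
FAdj G f (inj₁ a) (inj₁ b) = Adj G a b
FAdj G f (inj₂ a) (inj₂ b) = Adj G a b
FAdj G f (inj₁ a) (inj₂ b) = f a ≡ b
FAdj G f (inj₂ a) (inj₁ b) = f b ≡ a

FAdj-sym : ∀ {n} (G : Graph n) f x y → FAdj G f x y → FAdj G f y x
FAdj-sym G f (inj₁ a) (inj₁ b) p = sym G p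
FAdj-sym G f (inj₂ a) (inj₂ b) p = sym G p
FAdj-sym G f (inj₁ a) (inj₂ b) p = p
FAdj-sym G f (inj₂ a) (inj₁ b) p = p

FAdj-irr : ∀ {n} (G : Graph n) f x → ¬ FAdj G f x x
FAdj-irr G f (inj₁ a) = irrfl G
FAdj-irr G f (inj₂ a) = irrfl G

Functigraph : ∀ {n} → Graph n → (Fin n → Fin n) → Graph (n + n)
Functigraph {n} G f = record
  { Adj   = λ x y → FAdj G f (splitAt n x) (splitAt n y)
  ; sym   = λ {x} {y} → FAdj-sym G f (splitAt n x) (splitAt n y)
  ; irrfl = λ {x} → FAdj-irr G f (splitAt n x)
  }

Dominates : ∀ {n} → Graph n → Subset n → Subset n → Set
Dominates {n} G D S = ∀ (v : Fin n) → v ∈ S → v ∉ D → ∃ λ u → u ∈ D × Adj G u v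

IsDominatingSet : ∀ {n} → Graph n → Subset n → Set
IsDominatingSet G D = Dominates G D ⊤

IsMinDominatingSet : ∀ {n} → Graph n → Subset n → Set
IsMinDominatingSet {n} G D =
  IsDominatingSet G D × (∀ (D' : Subset n) → IsDominatingSet G D' → ∣ D ∣ ≤ ∣ D' ∣)

DomNumber : ∀ {n} → Graph n → ℕ → Set
DomNumber G k = ∃ λ D → IsMinDominatingSet G D × ∣ D ∣ ≡ k

image : ∀ {n} → (Fin n → Fin n) → Subset n → Subset n
image f D = tabulate λ v → does (any? λ u → (u ∈? D) ×-dec (f u ≟ v))

preimage : ∀ {n} → (Fin n → Fin n) → Subset n → Subset n
preimage f S = tabulate λ u → lookup S (f u)

-- A dominating set S of C(G,f) splits as S₁ ∪ S₂ with Sᵢ ⊆ V(Gᵢ), and S₂ ∪ f(S₁) then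
-- dominates G₂; since |S₂ ∪ f(S₁)| ≤ |S₂| + |S₁|, always γ(G) ≤ γ(C(G,f)). Equality holds
-- exactly when this projection loses nothing on some minimum S: f is injective on S₁ and
-- f(S₁) misses S₂, which are conditions (4) and (5); conditions (1) and (2) just say that
-- S₁ ∪ S₂ dominates C(G,f), and (6) follows from (5).
module Submission where

open import Defs
open import Data.Nat using (ℕ; suc; _+_; _≤_; s≤s)
open import Data.Nat.Properties
  using (≤-trans; ≤-reflexive; ≤-antisym; m≤m+n; +-suc; +-comm; +-identityʳ; +-monoʳ-≤; +-cancelˡ-≤; n≤0⇒n≡0; module ≤-Reasoning)
open import Data.Fin using (Fin; zero; suc; splitAt; join)
open import Data.Fin.Properties using (any?; _≟_; splitAt-join)
open import Data.Fin.Subset using (Subset; inside; outside; ∁; _∪_; _∩_; ⊥; ∣_∣; _∈_; _⊆_; ⁅_⁆)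
open import Data.Fin.Subset.Properties
  using (_∈?_; ∈⊤; ∉⊥; x∈⁅x⁆; ∣⁅x⁆∣≡1; ∣⊥∣≡0; p⊆q⇒∣p∣≤∣q∣; x∈p∪q⁺; x∈p∩q⁺; x∈p∩q⁻; x∈∁p⇒x∉p; x∉p⇒x∈∁p; Empty-unique)
open import Data.Vec using (_∷_; []; _++_; here; there)
import Data.Vec as Vec
open import Data.Vec.Properties using (lookup-splitAt; lookup∘tabulate; []=⇒lookup; lookup⇒[]=)
open import Data.Sum using (_⊎_; inj₁; inj₂)
open import Data.Product using (∃; ∃₂; _×_; _,_; proj₁; proj₂)
open import Data.Empty using (⊥-elim)
open import Function using (_∘_)
open import Function.Bundles using (_⇔_; mk⇔; Equivalence)
open import Function.Properties.Equivalence using () renaming (trans to ⇔-trans)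
open import Relation.Binary.PropositionalEquality
  using (_≡_; refl; trans; cong; subst; module ≡-Reasoning) renaming (sym to ≡-sym)
open import Relation.Nullary using (¬_; yes; no)
open import Relation.Nullary.Decidable using (_×-dec_; dec-true)

∣p++q∣≡∣p∣+∣q∣ : ∀ {m k} (p : Subset m) (q : Subset k) → ∣ p ++ q ∣ ≡ ∣ p ∣ + ∣ q ∣
∣p++q∣≡∣p∣+∣q∣ []            q = refl
∣p++q∣≡∣p∣+∣q∣ (inside  ∷ p) q = cong suc (∣p++q∣≡∣p∣+∣q∣ p q)
∣p++q∣≡∣p∣+∣q∣ (outside ∷ p) q = ∣p++q∣≡∣p∣+∣q∣ p q

∣p∪q∣+∣p∩q∣≡∣p∣+∣q∣ : ∀ {m} (p q : Subset m) → ∣ p ∪ q ∣ + ∣ p ∩ q ∣ ≡ ∣ p ∣ + ∣ q ∣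
∣p∪q∣+∣p∩q∣≡∣p∣+∣q∣ []            []            = refl
∣p∪q∣+∣p∩q∣≡∣p∣+∣q∣ (inside  ∷ p) (inside  ∷ q) = cong suc (begin
  ∣ p ∪ q ∣ + suc ∣ p ∩ q ∣  ≡⟨ +-suc _ _ ⟩
  suc (∣ p ∪ q ∣ + ∣ p ∩ q ∣) ≡⟨ cong suc (∣p∪q∣+∣p∩q∣≡∣p∣+∣q∣ p q) ⟩
  suc (∣ p ∣ + ∣ q ∣)         ≡⟨ ≡-sym (+-suc _ _) ⟩
  ∣ p ∣ + suc ∣ q ∣           ∎)
  where open ≡-Reasoning
∣p∪q∣+∣p∩q∣≡∣p∣+∣q∣ (inside  ∷ p) (outside ∷ q) = cong suc (∣p∪q∣+∣p∩q∣≡∣p∣+∣q∣ p q)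
∣p∪q∣+∣p∩q∣≡∣p∣+∣q∣ (outside ∷ p) (inside  ∷ q) =
  trans (cong suc (∣p∪q∣+∣p∩q∣≡∣p∣+∣q∣ p q)) (≡-sym (+-suc _ _))
∣p∪q∣+∣p∩q∣≡∣p∣+∣q∣ (outside ∷ p) (outside ∷ q) = ∣p∪q∣+∣p∩q∣≡∣p∣+∣q∣ p q

∣p∪q∣≤∣p∣+∣q∣ : ∀ {m} (p q : Subset m) → ∣ p ∪ q ∣ ≤ ∣ p ∣ + ∣ q ∣
∣p∪q∣≤∣p∣+∣q∣ p q = ≤-trans (m≤m+n _ _) (≤-reflexive (∣p∪q∣+∣p∩q∣≡∣p∣+∣q∣ p q))

p∩q≡⊥⇒∣p∪q∣≡∣p∣+∣q∣ : ∀ {m} (p q : Subset m) → p ∩ q ≡ ⊥ → ∣ p ∪ q ∣ ≡ ∣ p ∣ + ∣ q ∣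
p∩q≡⊥⇒∣p∪q∣≡∣p∣+∣q∣ {m} p q p∩q≡⊥ = begin
  ∣ p ∪ q ∣             ≡⟨ ≡-sym (+-identityʳ _) ⟩
  ∣ p ∪ q ∣ + 0         ≡⟨ cong (∣ p ∪ q ∣ +_) (≡-sym (∣⊥∣≡0 m)) ⟩
  ∣ p ∪ q ∣ + ∣ ⊥ {m} ∣ ≡⟨ cong (λ r → ∣ p ∪ q ∣ + ∣ r ∣) (≡-sym p∩q≡⊥) ⟩
  ∣ p ∪ q ∣ + ∣ p ∩ q ∣ ≡⟨ ∣p∪q∣+∣p∩q∣≡∣p∣+∣q∣ p q ⟩
  ∣ p ∣ + ∣ q ∣         ∎
  where open ≡-Reasoning

∣p∣≡0⇒p≡⊥ : ∀ {m} (p : Subset m) → ∣ p ∣ ≡ 0 → p ≡ ⊥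
∣p∣≡0⇒p≡⊥ []            _  = refl
∣p∣≡0⇒p≡⊥ (outside ∷ p) eq = cong (outside ∷_) (∣p∣≡0⇒p≡⊥ p eq)

∣p∣+∣q∣≤∣p∪q∣⇒p∩q≡⊥ : ∀ {m} (p q : Subset m) → ∣ p ∣ + ∣ q ∣ ≤ ∣ p ∪ q ∣ → p ∩ q ≡ ⊥
∣p∣+∣q∣≤∣p∪q∣⇒p∩q≡⊥ p q le = ∣p∣≡0⇒p≡⊥ (p ∩ q) (n≤0⇒n≡0 (+-cancelˡ-≤ ∣ p ∪ q ∣ _ 0 (begin
  ∣ p ∪ q ∣ + ∣ p ∩ q ∣ ≡⟨ ∣p∪q∣+∣p∩q∣≡∣p∣+∣q∣ p q ⟩
  ∣ p ∣ + ∣ q ∣         ≤⟨ le ⟩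
  ∣ p ∪ q ∣             ≡⟨ ≡-sym (+-identityʳ _) ⟩
  ∣ p ∪ q ∣ + 0         ∎)))
  where open ≤-Reasoning

∈-image⁺ : ∀ {n} (f : Fin n → Fin n) (D : Subset n) {u} → u ∈ D → f u ∈ image f D
∈-image⁺ f D {u} u∈D = lookup⇒[]= (f u) (image f D)
  (trans (lookup∘tabulate _ (f u)) (dec-true (any? λ w → (w ∈? D) ×-dec (f w ≟ f u)) (u , u∈D , refl)))

∈-image⁻ : ∀ {n} (f : Fin n → Fin n) (D : Subset n) {v} → v ∈ image f D → ∃ λ u → u ∈ D × f u ≡ v
∈-image⁻ f D {v} v∈fD
  with any? (λ u → (u ∈? D) ×-dec (f u ≟ v)) | trans (≡-sym (lookup∘tabulate _ v)) ([]=⇒lookup v∈fD)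
... | yes witness | _  = witness
... | no _        | ()

∈-preimage⁺ : ∀ {n} (f : Fin n → Fin n) (S : Subset n) {v} → f v ∈ S → v ∈ preimage f S
∈-preimage⁺ f S {v} fv∈S = lookup⇒[]= v (preimage f S) (trans (lookup∘tabulate _ v) ([]=⇒lookup fv∈S))

∈-preimage⁻ : ∀ {n} (f : Fin n → Fin n) (S : Subset n) {v} → v ∈ preimage f S → f v ∈ S
∈-preimage⁻ f S {v} v∈f⁻¹S = lookup⇒[]= (f v) S (trans (≡-sym (lookup∘tabulate _ v)) ([]=⇒lookup v∈f⁻¹S))

-- The image computed by recursion on the subset, so that its size is bounded by induction.
imageRec : ∀ {m n} → (Fin m → Fin n) → Subset m → Subset n
imageRec g []            = ⊥
imageRec g (inside  ∷ D) = ⁅ g zero ⁆ ∪ imageRec (g ∘ suc) D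
imageRec g (outside ∷ D) = imageRec (g ∘ suc) D

∈-imageRec⁺ : ∀ {m n} (g : Fin m → Fin n) (D : Subset m) {u} → u ∈ D → g u ∈ imageRec g D
∈-imageRec⁺ g (inside  ∷ D) here        = x∈p∪q⁺ (inj₁ (x∈⁅x⁆ (g zero)))
∈-imageRec⁺ g (inside  ∷ D) (there u∈D) = x∈p∪q⁺ (inj₂ (∈-imageRec⁺ (g ∘ suc) D u∈D))
∈-imageRec⁺ g (outside ∷ D) (there u∈D) = ∈-imageRec⁺ (g ∘ suc) D u∈D

∣imageRec∣≤∣p∣ : ∀ {m n} (g : Fin m → Fin n) (D : Subset m) → ∣ imageRec g D ∣ ≤ ∣ D ∣
∣imageRec∣≤∣p∣ {n = n} g []    = ≤-reflexive (∣⊥∣≡0 n)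
∣imageRec∣≤∣p∣ g (inside  ∷ D) = begin
  ∣ ⁅ g zero ⁆ ∪ imageRec (g ∘ suc) D ∣         ≤⟨ ∣p∪q∣≤∣p∣+∣q∣ ⁅ g zero ⁆ _ ⟩
  ∣ ⁅ g zero ⁆ ∣ + ∣ imageRec (g ∘ suc) D ∣     ≡⟨ cong (_+ ∣ imageRec (g ∘ suc) D ∣) (∣⁅x⁆∣≡1 (g zero)) ⟩
  suc ∣ imageRec (g ∘ suc) D ∣                  ≤⟨ s≤s (∣imageRec∣≤∣p∣ (g ∘ suc) D) ⟩
  suc ∣ D ∣                                     ∎
  where open ≤-Reasoning
∣imageRec∣≤∣p∣ g (outside ∷ D) = ∣imageRec∣≤∣p∣ (g ∘ suc) D

∣image∣≤∣p∣ : ∀ {n} (f : Fin n → Fin n) (D : Subset n) → ∣ image f D ∣ ≤ ∣ D ∣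
∣image∣≤∣p∣ f D = ≤-trans (p⊆q⇒∣p∣≤∣q∣ image⊆imageRec) (∣imageRec∣≤∣p∣ f D)
  where
  image⊆imageRec : image f D ⊆ imageRec f D
  image⊆imageRec v∈fD with ∈-image⁻ f D v∈fD
  ... | u , u∈D , refl = ∈-imageRec⁺ f D u∈D

image∩≡⊥⇒∩preimage≡⊥ : ∀ {n} (f : Fin n → Fin n) (D S : Subset n) →
  S ∩ image f D ≡ ⊥ → D ∩ preimage f S ≡ ⊥
image∩≡⊥⇒∩preimage≡⊥ f D S disjoint = Empty-unique λ where
  (u , u∈D∩f⁻¹S) → let u∈D , u∈f⁻¹S = x∈p∩q⁻ D _ u∈D∩f⁻¹S in
    ∉⊥ (subst (f u ∈_) disjoint (x∈p∩q⁺ (∈-preimage⁻ f S u∈f⁻¹S , ∈-image⁺ f D u∈D)))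

_∈⊎_ : ∀ {n} → Fin n ⊎ Fin n → Subset n × Subset n → Set
inj₁ u ∈⊎ (S₁ , S₂) = u ∈ S₁
inj₂ v ∈⊎ (S₁ , S₂) = v ∈ S₂

∈-++⇔∈⊎ : ∀ {n} (S₁ S₂ : Subset n) (x : Fin (n + n)) → x ∈ S₁ ++ S₂ ⇔ splitAt n x ∈⊎ (S₁ , S₂)
∈-++⇔∈⊎ {n} S₁ S₂ x with splitAt n x | lookup-splitAt n S₁ S₂ x
... | inj₁ u | lookup≡ = mk⇔
  (λ x∈S → lookup⇒[]= u S₁ (trans (≡-sym lookup≡) ([]=⇒lookup x∈S)))
  (λ u∈S₁ → lookup⇒[]= x (S₁ ++ S₂) (trans lookup≡ ([]=⇒lookup u∈S₁)))
... | inj₂ v | lookup≡ = mk⇔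
  (λ x∈S → lookup⇒[]= v S₂ (trans (≡-sym lookup≡) ([]=⇒lookup x∈S)))
  (λ v∈S₂ → lookup⇒[]= x (S₁ ++ S₂) (trans lookup≡ ([]=⇒lookup v∈S₂)))

DominatesFunctigraph : ∀ {n} → Graph n → (Fin n → Fin n) → Subset n × Subset n → Set
DominatesFunctigraph G f S = ∀ y → ¬ y ∈⊎ S → ∃ λ z → z ∈⊎ S × FAdj G f z y

dominating-++⇔DominatesFunctigraph : ∀ {n} (G : Graph n) f (S₁ S₂ : Subset n) →
  IsDominatingSet (Functigraph G f) (S₁ ++ S₂) ⇔ DominatesFunctigraph G f (S₁ , S₂)
dominating-++⇔DominatesFunctigraph {n} G f S₁ S₂ = mk⇔ to from
  where
  module ∈S (x : Fin (n + n)) = Equivalence (∈-++⇔∈⊎ S₁ S₂ x)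

  to : IsDominatingSet (Functigraph G f) (S₁ ++ S₂) → DominatesFunctigraph G f (S₁ , S₂)
  to dominating y y∉S with dominating (join n n y) ∈⊤
    (y∉S ∘ subst (_∈⊎ (S₁ , S₂)) (splitAt-join n n y) ∘ ∈S.to (join n n y))
  ... | z , z∈S , adj = splitAt n z , ∈S.to z z∈S , subst (FAdj G f (splitAt n z)) (splitAt-join n n y) adj

  from : DominatesFunctigraph G f (S₁ , S₂) → IsDominatingSet (Functigraph G f) (S₁ ++ S₂)
  from dominating x _ x∉S with dominating (splitAt n x) (x∉S ∘ ∈S.from x)
  ... | z , z∈S , adj = join n n z
    , ∈S.from (join n n z) (subst (_∈⊎ (S₁ , S₂)) (≡-sym (splitAt-join n n z)) z∈S)
    , subst (λ w → FAdj G f w (splitAt n x)) (≡-sym (splitAt-join n n z)) adj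

DominatesFunctigraph⇔dominates-layers : ∀ {n} (G : Graph n) f (S₁ S₂ : Subset n) →
  DominatesFunctigraph G f (S₁ , S₂) ⇔
  (Dominates G S₁ (∁ (preimage f S₂)) × Dominates G S₂ (∁ (image f S₁)))
DominatesFunctigraph⇔dominates-layers G f S₁ S₂ = mk⇔ to from
  where
  to : DominatesFunctigraph G f (S₁ , S₂) →
       Dominates G S₁ (∁ (preimage f S₂)) × Dominates G S₂ (∁ (image f S₁))
  to dominating = layer₁ , layer₂
    where
    layer₁ : Dominates G S₁ (∁ (preimage f S₂))
    layer₁ u u∉f⁻¹S₂ u∉S₁ with dominating (inj₁ u) u∉S₁
    ... | inj₁ w , w∈S₁ , adj  = w , w∈S₁ , adj
    ... | inj₂ w , w∈S₂ , refl = ⊥-elim (x∈∁p⇒x∉p u∉f⁻¹S₂ (∈-preimage⁺ f S₂ w∈S₂))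
    layer₂ : Dominates G S₂ (∁ (image f S₁))
    layer₂ v v∉fS₁ v∉S₂ with dominating (inj₂ v) v∉S₂
    ... | inj₁ w , w∈S₁ , refl = ⊥-elim (x∈∁p⇒x∉p v∉fS₁ (∈-image⁺ f S₁ w∈S₁))
    ... | inj₂ w , w∈S₂ , adj  = w , w∈S₂ , adj

  from : Dominates G S₁ (∁ (preimage f S₂)) × Dominates G S₂ (∁ (image f S₁)) →
         DominatesFunctigraph G f (S₁ , S₂)
  from (layer₁ , layer₂) (inj₁ u) u∉S₁ with u ∈? preimage f S₂
  ... | yes u∈f⁻¹S₂ = inj₂ (f u) , ∈-preimage⁻ f S₂ u∈f⁻¹S₂ , refl
  ... | no  u∉f⁻¹S₂ with layer₁ u (x∉p⇒x∈∁p u∉f⁻¹S₂) u∉S₁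
  ...   | w , w∈S₁ , adj = inj₁ w , w∈S₁ , adj
  from (layer₁ , layer₂) (inj₂ v) v∉S₂ with v ∈? image f S₁
  ... | yes v∈fS₁ with ∈-image⁻ f S₁ v∈fS₁
  ...   | w , w∈S₁ , fw≡v = inj₁ w , w∈S₁ , fw≡v
  from (layer₁ , layer₂) (inj₂ v) v∉S₂ | no v∉fS₁ with layer₂ v (x∉p⇒x∈∁p v∉fS₁) v∉S₂
  ...   | w , w∈S₂ , adj = inj₂ w , w∈S₂ , adj

functigraph-dominating⇔ : ∀ {n} (G : Graph n) f (S₁ S₂ : Subset n) →
  IsDominatingSet (Functigraph G f) (S₁ ++ S₂) ⇔
  (Dominates G S₁ (∁ (preimage f S₂)) × Dominates G S₂ (∁ (image f S₁)))
functigraph-dominating⇔ G f S₁ S₂ = ⇔-trans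
  (dominating-++⇔DominatesFunctigraph G f S₁ S₂) (DominatesFunctigraph⇔dominates-layers G f S₁ S₂)

dominates-∁⇒dominating-∪ : ∀ {n} (G : Graph n) (D X : Subset n) →
  Dominates G D (∁ X) → IsDominatingSet G (D ∪ X)
dominates-∁⇒dominating-∪ G D X dominates v _ v∉D∪X
  with dominates v (x∉p⇒x∈∁p (v∉D∪X ∘ x∈p∪q⁺ ∘ inj₂)) (v∉D∪X ∘ x∈p∪q⁺ ∘ inj₁)
... | u , u∈D , adj = u , x∈p∪q⁺ (inj₁ u∈D) , adj

∣q∪image∣≤∣p++q∣ : ∀ {n} (f : Fin n → Fin n) (S₁ S₂ : Subset n) → ∣ S₂ ∪ image f S₁ ∣ ≤ ∣ S₁ ++ S₂ ∣
∣q∪image∣≤∣p++q∣ f S₁ S₂ = begin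
  ∣ S₂ ∪ image f S₁ ∣       ≤⟨ ∣p∪q∣≤∣p∣+∣q∣ S₂ (image f S₁) ⟩
  ∣ S₂ ∣ + ∣ image f S₁ ∣   ≤⟨ +-monoʳ-≤ ∣ S₂ ∣ (∣image∣≤∣p∣ f S₁) ⟩
  ∣ S₂ ∣ + ∣ S₁ ∣           ≡⟨ +-comm ∣ S₂ ∣ ∣ S₁ ∣ ⟩
  ∣ S₁ ∣ + ∣ S₂ ∣           ≡⟨ ≡-sym (∣p++q∣≡∣p∣+∣q∣ S₁ S₂) ⟩
  ∣ S₁ ++ S₂ ∣              ∎
  where open ≤-Reasoning

functigraph-dominating⇒projection-dominating : ∀ {n} (G : Graph n) f (S₁ S₂ : Subset n) →
  IsDominatingSet (Functigraph G f) (S₁ ++ S₂) → IsDominatingSet G (S₂ ∪ image f S₁)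
functigraph-dominating⇒projection-dominating G f S₁ S₂ =
  dominates-∁⇒dominating-∪ G S₂ (image f S₁) ∘ proj₂ ∘ Equivalence.to (functigraph-dominating⇔ G f S₁ S₂)

min-dominating≤functigraph-dominating : ∀ {n} (G : Graph n) f {E : Subset n} {S : Subset (n + n)} →
  IsMinDominatingSet G E → IsDominatingSet (Functigraph G f) S → ∣ E ∣ ≤ ∣ S ∣
min-dominating≤functigraph-dominating {n} G f {S = S} (_ , minimal) dominating with Vec.splitAt n S
... | S₁ , S₂ , refl = ≤-trans
  (minimal _ (functigraph-dominating⇒projection-dominating G f S₁ S₂ dominating))
  (∣q∪image∣≤∣p++q∣ f S₁ S₂)

MinimumLift : ∀ {n} → Graph n → (Fin n → Fin n) → Subset n → Subset n → Set
MinimumLift G f D₁ D₂ =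
    Dominates G D₁ (∁ (preimage f D₂))
  × Dominates G D₂ (∁ (image f D₁))
  × IsMinDominatingSet G (D₂ ∪ image f D₁)
  × ∣ D₁ ∣ ≡ ∣ image f D₁ ∣
  × D₂ ∩ image f D₁ ≡ ⊥
  × D₁ ∩ preimage f D₂ ≡ ⊥

functigraph-dominating-of-size-γ⇒lift : ∀ {n} (G : Graph n) f {D : Subset n} (S₁ S₂ : Subset n) →
  IsMinDominatingSet G D → IsDominatingSet (Functigraph G f) (S₁ ++ S₂) → ∣ S₁ ++ S₂ ∣ ≡ ∣ D ∣ →
  MinimumLift G f S₁ S₂
functigraph-dominating-of-size-γ⇒lift G f {D} S₁ S₂ (_ , minimalD) dominatingS |S|≡|D| =
  proj₁ layers , proj₂ layers , (dominatingE , minimalE) ,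
  ≤-antisym |S₁|≤|fS₁| (∣image∣≤∣p∣ f S₁) , disjoint , image∩≡⊥⇒∩preimage≡⊥ f S₁ S₂ disjoint
  where
  open ≤-Reasoning
  fS₁ : Subset _
  fS₁ = image f S₁

  layers : Dominates G S₁ (∁ (preimage f S₂)) × Dominates G S₂ (∁ fS₁)
  layers = Equivalence.to (functigraph-dominating⇔ G f S₁ S₂) dominatingS

  dominatingE : IsDominatingSet G (S₂ ∪ fS₁)
  dominatingE = dominates-∁⇒dominating-∪ G S₂ fS₁ (proj₂ layers)

  |S₂|+|S₁|≤|E| : ∣ S₂ ∣ + ∣ S₁ ∣ ≤ ∣ S₂ ∪ fS₁ ∣
  |S₂|+|S₁|≤|E| = begin
    ∣ S₂ ∣ + ∣ S₁ ∣  ≡⟨ +-comm ∣ S₂ ∣ ∣ S₁ ∣ ⟩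
    ∣ S₁ ∣ + ∣ S₂ ∣  ≡⟨ ≡-sym (∣p++q∣≡∣p∣+∣q∣ S₁ S₂) ⟩
    ∣ S₁ ++ S₂ ∣     ≡⟨ |S|≡|D| ⟩
    ∣ D ∣            ≤⟨ minimalD _ dominatingE ⟩
    ∣ S₂ ∪ fS₁ ∣     ∎

  |S₁|≤|fS₁| : ∣ S₁ ∣ ≤ ∣ fS₁ ∣
  |S₁|≤|fS₁| = +-cancelˡ-≤ ∣ S₂ ∣ _ _ (≤-trans |S₂|+|S₁|≤|E| (∣p∪q∣≤∣p∣+∣q∣ S₂ fS₁))

  disjoint : S₂ ∩ fS₁ ≡ ⊥
  disjoint = ∣p∣+∣q∣≤∣p∪q∣⇒p∩q≡⊥ S₂ fS₁ (≤-trans (+-monoʳ-≤ ∣ S₂ ∣ (∣image∣≤∣p∣ f S₁)) |S₂|+|S₁|≤|E|)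

  minimalE : ∀ D′ → IsDominatingSet G D′ → ∣ S₂ ∪ fS₁ ∣ ≤ ∣ D′ ∣
  minimalE D′ dominatingD′ = begin
    ∣ S₂ ∪ fS₁ ∣  ≤⟨ ∣q∪image∣≤∣p++q∣ f S₁ S₂ ⟩
    ∣ S₁ ++ S₂ ∣  ≡⟨ |S|≡|D| ⟩
    ∣ D ∣         ≤⟨ minimalD D′ dominatingD′ ⟩
    ∣ D′ ∣        ∎

lift⇒functigraph-min-dominating : ∀ {n} (G : Graph n) f (D₁ D₂ : Subset n) → MinimumLift G f D₁ D₂ →
  IsMinDominatingSet (Functigraph G f) (D₁ ++ D₂) × ∣ D₁ ++ D₂ ∣ ≡ ∣ D₂ ∪ image f D₁ ∣
lift⇒functigraph-min-dominating G f D₁ D₂ (layer₁ , layer₂ , minimumE , |D₁|≡|fD₁| , disjoint , _) =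
  (dominating , minimal) , size
  where
  dominating : IsDominatingSet (Functigraph G f) (D₁ ++ D₂)
  dominating = Equivalence.from (functigraph-dominating⇔ G f D₁ D₂) (layer₁ , layer₂)

  size : ∣ D₁ ++ D₂ ∣ ≡ ∣ D₂ ∪ image f D₁ ∣
  size = begin
    ∣ D₁ ++ D₂ ∣                ≡⟨ ∣p++q∣≡∣p∣+∣q∣ D₁ D₂ ⟩
    ∣ D₁ ∣ + ∣ D₂ ∣             ≡⟨ cong (_+ ∣ D₂ ∣) |D₁|≡|fD₁| ⟩
    ∣ image f D₁ ∣ + ∣ D₂ ∣     ≡⟨ +-comm _ ∣ D₂ ∣ ⟩
    ∣ D₂ ∣ + ∣ image f D₁ ∣     ≡⟨ ≡-sym (p∩q≡⊥⇒∣p∪q∣≡∣p∣+∣q∣ D₂ (image f D₁) disjoint) ⟩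
    ∣ D₂ ∪ image f D₁ ∣         ∎
    where open ≡-Reasoning

  minimal : ∀ S → IsDominatingSet (Functigraph G f) S → ∣ D₁ ++ D₂ ∣ ≤ ∣ S ∣
  minimal S dominatingS = ≤-trans (≤-reflexive size) (min-dominating≤functigraph-dominating G f minimumE dominatingS)

theorem3p1 : ∀ {n : ℕ} (G : Graph n) → Connected G → (f : Fin n → Fin n) →
    (∃ λ (k : ℕ) → DomNumber G k × DomNumber (Functigraph G f) k)
    ⇔ (∃₂ λ (D₁ D₂ : Subset n) →
         Dominates G D₁ (∁ (preimage f D₂))
       × Dominates G D₂ (∁ (image f D₁))
       × IsMinDominatingSet G (D₂ ∪ image f D₁)
       × ∣ D₁ ∣ ≡ ∣ image f D₁ ∣
       × D₂ ∩ image f D₁ ≡ ⊥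
       × D₁ ∩ preimage f D₂ ≡ ⊥)
theorem3p1 {n} G _ f = mk⇔ equal⇒lift lift⇒equal
  where
  equal⇒lift : (∃ λ k → DomNumber G k × DomNumber (Functigraph G f) k) → ∃₂ (MinimumLift G f)
  equal⇒lift (k , (D , minimumD , |D|≡k) , (S , (dominatingS , _) , |S|≡k)) with Vec.splitAt n S
  ... | S₁ , S₂ , refl = S₁ , S₂ ,
    functigraph-dominating-of-size-γ⇒lift G f S₁ S₂ minimumD dominatingS (trans |S|≡k (≡-sym |D|≡k))

  lift⇒equal : ∃₂ (MinimumLift G f) → ∃ λ k → DomNumber G k × DomNumber (Functigraph G f) k
  lift⇒equal (D₁ , D₂ , lift@(_ , _ , minimumE , _)) =
    let minimumD , size = lift⇒functigraph-min-dominating G f D₁ D₂ lift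
    in ∣ D₂ ∪ image f D₁ ∣ , (D₂ ∪ image f D₁ , minimumE , refl) , (D₁ ++ D₂ , minimumD , size)
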